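{- Every instance of Course Allocation with a master list of students has a unique pair-stable matching.
   Context: An instance of Course Allocation consists of a finite set $S$ of students and a finite set $C$ of courses. Each student $s_i$ has a strict preference order $\succ_{s_i}$ over a set $P(s_i)\subseteq C$ of acceptable courses, and each course $c_j$ has a strict preference order $\succ_{c_j}$ over $P(c_j)\subseteq S$, with $c_j\in P(s_i)$ iff $s_i\in P(c_j)$ (an acceptable pair). Each course $c_j$ has a positive number of credits $O(c_j)$ and an upper quota $q^+(c_j)$; $O(D)=\sum_{c\in D}O(c)$. Each student $s_i$ has a credit limit $T(s_i)$. For a set $M$ of acceptable pairs let $C_M(s_i)=\{c:(s_i,c)\in M\}$, $S_M(c_j)=\{s:(s,c_j)\in M\}$. $M$ is a matching if $O(C_M(s_i))\le T(s_i)$ and $|S_M(c_j)|\le q^+(c_j)$ for all students and courses; $c_j$ is undersubscribed if $|S_M(c_j)|<q^+(c_j)$. The instance has a master list of students if there is a strict total order $\succ_{MLS}$ on $S$ such that for every course $c_j$ and $s,s'\in P(c_j)$, $s\succ_{c_j}s'$ iff $s\succ_{MLS}s'$. A blocking pair of $M$ is an acceptable pair $(s_i,c_j)\notin M$ such that $c_j$ is undersubscribed or $s_i\succ_{c_j}s_k$ for some $s_k\in S_M(c_j)$, and there is $D\subseteq C_M(s_i)$ (possibly empty) with $c_j\succ_{s_i}c$ for all $c\in D$ and $O(C_M(s_i))-O(D)+O(c_j)\le T(s_i)$. $M$ is pair-stable if it has no blocking pair. -}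

module Defs where

open import Data.Nat using (ℕ; _+_; _∸_; _≤_; _<_)
open import Data.Fin using (Fin)
open import Data.Bool using (Bool; true; false; if_then_else_)
open import Data.List using (List; map; allFin)
open import Data.Nat.ListAction using (sum)
open import Data.Empty using (⊥)
open import Data.Product using (Σ; ∃; _×_; _,_)
open import Data.Sum using (_⊎_)
open import Relation.Binary.PropositionalEquality using (_≡_)
open import Function.Bundles using (_⇔_)

Σᶠ : ∀ {n} → (Fin n → ℕ) → ℕ
Σᶠ {n} f = sum (map f (allFin n))

-- A strict total order on the acceptable elements, given by an injective rank
-- (smaller rank = more preferred).
InjectiveOn : ∀ {n} → (Fin n → Bool) → (Fin n → ℕ) → Set
InjectiveOn P r = ∀ x y → P x ≡ true → P y ≡ true → r x ≡ r y → x ≡ y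

-- An instance of Course Allocation.  Students are Fin nS, courses Fin nC.
-- acc s c = true iff (s , c) is an acceptable pair (this encodes c ∈ P(s) iff s ∈ P(c)).
record Instance : Set where
  field
    nS nC   : ℕ
    acc     : Fin nS → Fin nC → Bool
    srank   : Fin nS → Fin nC → ℕ
    srank-inj : ∀ s → InjectiveOn (acc s) (srank s)
    crank   : Fin nC → Fin nS → ℕ
    crank-inj : ∀ c → InjectiveOn (λ s → acc s c) (crank c)
    O       : Fin nC → ℕ               -- credits
    O-pos   : ∀ c → 1 ≤ O c
    q⁺      : Fin nC → ℕ               -- upper quota
    q⁺-pos  : ∀ c → 1 ≤ q⁺ c
    T       : Fin nS → ℕ               -- credit limit

module _ (I : Instance) where
  open Instance I

  _≻[_]ˢ_ : Fin nS → Fin nC → Fin nS → Set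
  s ≻[ c ]ˢ s' = crank c s < crank c s'

  _≻[_]ᶜ_ : Fin nC → Fin nS → Fin nC → Set
  c ≻[ s ]ᶜ c' = srank s c < srank s c'

  HasMasterList : Set
  HasMasterList =
    Σ (Fin nS → ℕ) λ mls →
      (∀ s s' → mls s ≡ mls s' → s ≡ s') ×
      (∀ c s s' → acc s c ≡ true → acc s' c ≡ true →
         ((s ≻[ c ]ˢ s') ⇔ (mls s < mls s')))

  PairSet : Set
  PairSet = Fin nS → Fin nC → Bool

  credits : (Fin nC → Bool) → ℕ
  credits D = Σᶠ (λ c → if D c then O c else 0)

  load : PairSet → Fin nS → ℕ
  load M s = credits (M s)

  size : PairSet → Fin nC → ℕ
  size M c = Σᶠ (λ s → if M s c then 1 else 0)

  IsMatching : PairSet → Set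
  IsMatching M =
    (∀ s c → M s c ≡ true → acc s c ≡ true) ×
    (∀ s → load M s ≤ T s) ×
    (∀ c → size M c ≤ q⁺ c)

  Undersubscribed : PairSet → Fin nC → Set
  Undersubscribed M c = size M c < q⁺ c

  BlockingPair : PairSet → Fin nS → Fin nC → Set
  BlockingPair M s c =
    acc s c ≡ true × M s c ≡ false ×
    (Undersubscribed M c ⊎ (∃ λ s' → M s' c ≡ true × s ≻[ c ]ˢ s')) ×
    (Σ (Fin nC → Bool) λ D →
       (∀ c' → D c' ≡ true → M s c' ≡ true) ×
       (∀ c' → D c' ≡ true → c ≻[ s ]ᶜ c') ×
       (load M s ∸ credits D + O c ≤ T s))

  PairStable : PairSet → Set
  PairStable M = IsMatching M × (∀ s c → BlockingPair M s c → ⊥)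

-- Order the pairs (s, c) lexicographically by the position of s on the master list and
-- then by s's preference for c. In any matching M, call (s, c) admissible when c is
-- acceptable to s, fewer than q⁺ c students ahead of s hold c, and the credits s holds in
-- courses it prefers to c leave room for O c. A matched pair is always admissible, and an
-- admissible unmatched pair blocks M (s drops every course it likes less than c); so M is
-- pair-stable iff it consists exactly of its admissible pairs. Admissibility of (s, c)
-- depends only on the pairs of M before (s, c), so this fixed-point equation has a unique
-- solution, reached by applying it once per pair: serial dictatorship along the master list.

module Submission where

open import Defs
open import Data.Product using (Σ; _×_)
open import Relation.Binary.PropositionalEquality using (_≡_)

open import Data.Bool using (Bool; true; false; if_then_else_)
open import Data.Bool.Properties using (¬-not; not-¬) renaming (_≟_ to _≟ᵇ_)
open import Data.Empty using (⊥; ⊥-elim)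
open import Data.Fin using (Fin; zero; suc)
open import Data.Fin.Properties using (any?) renaming (_≟_ to _≟ᶠ_; suc-injective to fsuc-injective)
open import Data.List using (allFin; tabulate)
open import Data.List.Properties using (map-tabulate; map-cong)
open import Data.Nat using (ℕ; zero; suc; _+_; _*_; _∸_; _≤_; _<_; z≤n; s≤s; s≤s⁻¹; _<?_; _≤?_)
open import Data.Nat.ListAction using (sum)
open import Data.Nat.Properties
open import Algebra.Properties.CommutativeSemigroup +-commutativeSemigroup using (interchange)
open import Data.Product using (∃; _,_; proj₁; proj₂)
open import Data.Sum using (_⊎_; inj₁; inj₂)
open import Function using (_∘_; id; _⇔_; mk⇔; Equivalence)
open import Relation.Binary.Definitions using (tri<; tri≈; tri>)
open import Relation.Binary.PropositionalEquality using (refl; sym; trans; cong; cong₂; subst; _≢_; module ≡-Reasoning)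
open import Relation.Nullary using (¬_; Dec; yes; no; does; contradiction; _×-dec_)
open import Relation.Nullary.Decidable using (dec-true; does-⇔)

open Equivalence using (to; from)

does≡true⇔ : ∀ {a} {A : Set a} (a? : Dec A) → does a? ≡ true ⇔ A
does≡true⇔ (yes a) = mk⇔ (λ _ → a) (λ _ → refl)
does≡true⇔ (no ¬a) = mk⇔ (λ ()) (λ a → contradiction a ¬a)

≡true-⇔⇒≡ : ∀ {a b : Bool} → (a ≡ true → b ≡ true) → (b ≡ true → a ≡ true) → a ≡ b
≡true-⇔⇒≡ {false} {false} _ _ = refl
≡true-⇔⇒≡ {false} {true}  _ b⇒a = b⇒a refl
≡true-⇔⇒≡ {true}  a⇒b _ = sym (a⇒b refl)

Σᶠ-tabulate : ∀ {n} (f : Fin n → ℕ) → Σᶠ f ≡ sum (tabulate f)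
Σᶠ-tabulate f = cong sum (map-tabulate id f)

Σᶠ-suc : ∀ {n} (f : Fin (suc n) → ℕ) → Σᶠ f ≡ f zero + Σᶠ (f ∘ suc)
Σᶠ-suc f = trans (Σᶠ-tabulate f) (cong (f zero +_) (sym (Σᶠ-tabulate (f ∘ suc))))

Σᶠ-cong : ∀ {n} {f g : Fin n → ℕ} → (∀ x → f x ≡ g x) → Σᶠ f ≡ Σᶠ g
Σᶠ-cong f≗g = cong sum (map-cong f≗g (allFin _))

Σᶠ-mono-≤ : ∀ {n} {f g : Fin n → ℕ} → (∀ x → f x ≤ g x) → Σᶠ f ≤ Σᶠ g
Σᶠ-mono-≤ {zero}          _   = z≤n
Σᶠ-mono-≤ {suc n} {f} {g} f≤g rewrite Σᶠ-suc f | Σᶠ-suc g =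
  +-mono-≤ (f≤g zero) (Σᶠ-mono-≤ (f≤g ∘ suc))

Σᶠ-distrib-+ : ∀ {n} (f g : Fin n → ℕ) → Σᶠ (λ x → f x + g x) ≡ Σᶠ f + Σᶠ g
Σᶠ-distrib-+ {zero}  f g = refl
Σᶠ-distrib-+ {suc n} f g = begin
  Σᶠ (λ x → f x + g x)                              ≡⟨ Σᶠ-suc (λ x → f x + g x) ⟩
  f zero + g zero + Σᶠ (λ x → f (suc x) + g (suc x)) ≡⟨ cong (f zero + g zero +_) (Σᶠ-distrib-+ (f ∘ suc) (g ∘ suc)) ⟩
  f zero + g zero + (Σᶠ (f ∘ suc) + Σᶠ (g ∘ suc))    ≡⟨ interchange (f zero) (g zero) (Σᶠ (f ∘ suc)) (Σᶠ (g ∘ suc)) ⟩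
  f zero + Σᶠ (f ∘ suc) + (g zero + Σᶠ (g ∘ suc))    ≡⟨ sym (cong₂ _+_ (Σᶠ-suc f) (Σᶠ-suc g)) ⟩
  Σᶠ f + Σᶠ g                                        ∎
  where open ≡-Reasoning

Σᶠ-zero : ∀ {n} {f : Fin n → ℕ} → (∀ x → f x ≡ 0) → Σᶠ f ≡ 0
Σᶠ-zero {zero}      _   = refl
Σᶠ-zero {suc n} {f} f≡0 rewrite Σᶠ-suc f | f≡0 zero = Σᶠ-zero (f≡0 ∘ suc)

Σᶠ-supported-at : ∀ {n} {f : Fin n → ℕ} x → (∀ y → y ≢ x → f y ≡ 0) → Σᶠ f ≡ f x
Σᶠ-supported-at {suc n} {f} zero off rewrite Σᶠ-suc f =
  trans (cong (f zero +_) (Σᶠ-zero (λ y → off (suc y) λ ()))) (+-identityʳ _)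
Σᶠ-supported-at {suc n} {f} (suc x) off rewrite Σᶠ-suc f | off zero (λ ()) =
  Σᶠ-supported-at x (λ y y≢x → off (suc y) (y≢x ∘ fsuc-injective))

≤Σᶠ : ∀ {n} (f : Fin n → ℕ) x → f x ≤ Σᶠ f
≤Σᶠ f zero    rewrite Σᶠ-suc f = m≤m+n _ _
≤Σᶠ f (suc x) rewrite Σᶠ-suc f = ≤-trans (≤Σᶠ (f ∘ suc) x) (m≤n+m _ _)

weight : ∀ {n} → (Fin n → Bool) → (Fin n → ℕ) → ℕ
weight A w = Σᶠ (λ y → if A y then w y else 0)

_⊆_ : ∀ {n} → (Fin n → Bool) → (Fin n → Bool) → Set
A ⊆ B = ∀ {y} → A y ≡ true → B y ≡ true

｛_｝ : ∀ {n} → Fin n → Fin n → Bool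
｛ x ｝ y = does (y ≟ᶠ x)

module _ {n : ℕ} {w : Fin n → ℕ} where

  private
    masked : (Fin n → Bool) → Fin n → ℕ
    masked A y = if A y then w y else 0

  weight-cong : {A B : Fin n → Bool} → (∀ y → A y ≡ B y) → weight A w ≡ weight B w
  weight-cong A≗B = Σᶠ-cong (λ y → cong (λ b → if b then w y else 0) (A≗B y))

  weight-empty : {A : Fin n → Bool} → (∀ y → A y ≡ false) → weight A w ≡ 0
  weight-empty A≗∅ = Σᶠ-zero (λ y → cong (λ b → if b then w y else 0) (A≗∅ y))

  weight-mono : {A B : Fin n → Bool} → A ⊆ B → weight A w ≤ weight B w
  weight-mono {A} {B} A⊆B = Σᶠ-mono-≤ pointwise
    where
    pointwise : ∀ y → masked A y ≤ masked B y
    pointwise y with A y in a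
    ... | false = z≤n
    ... | true rewrite A⊆B a = ≤-refl

  weight-disjoint : {A B P : Fin n → Bool} → A ⊆ P → B ⊆ P →
                    (∀ {y} → A y ≡ true → B y ≡ true → ⊥) →
                    weight A w + weight B w ≤ weight P w
  weight-disjoint {A} {B} {P} A⊆P B⊆P disjoint =
    subst (_≤ weight P w) (Σᶠ-distrib-+ (masked A) (masked B)) (Σᶠ-mono-≤ pointwise)
    where
    pointwise : ∀ y → masked A y + masked B y ≤ masked P y
    pointwise y with A y in a | B y in b
    ... | true  | true  = ⊥-elim (disjoint a b)
    ... | true  | false rewrite A⊆P a = ≤-reflexive (+-identityʳ (w y))
    ... | false | true  rewrite B⊆P b = ≤-refl
    ... | false | false = z≤n

  weight-cover : {A B P : Fin n → Bool} → (∀ {y} → P y ≡ true → A y ≡ true ⊎ B y ≡ true) →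
                 weight P w ≤ weight A w + weight B w
  weight-cover {A} {B} {P} cover =
    subst (weight P w ≤_) (Σᶠ-distrib-+ (masked A) (masked B)) (Σᶠ-mono-≤ pointwise)
    where
    pointwise : ∀ y → masked P y ≤ masked A y + masked B y
    pointwise y with P y in p
    ... | false = z≤n
    ... | true with cover p
    ...   | inj₁ a rewrite a = m≤m+n _ _
    ...   | inj₂ b rewrite b = m≤n+m _ _

  weight-singleton : ∀ x → weight ｛ x ｝ w ≡ w x
  weight-singleton x = trans (Σᶠ-supported-at x off) on-x
    where
    off : ∀ y → y ≢ x → masked ｛ x ｝ y ≡ 0
    off y y≢x with y ≟ᶠ x
    ... | yes y≡x = contradiction y≡x y≢x
    ... | no _    = refl
    on-x : masked ｛ x ｝ x ≡ w x
    on-x rewrite dec-true (x ≟ᶠ x) refl = refl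

maximumOn : ∀ {n} (P : Fin n → Bool) (r : Fin n → ℕ) →
            (∀ y → P y ≡ false) ⊎ ∃ λ x → P x ≡ true × (∀ {y} → P y ≡ true → r y ≤ r x)
maximumOn {zero}  P r = inj₁ λ ()
maximumOn {suc n} P r with P zero in p₀ | maximumOn (P ∘ suc) (r ∘ suc)
... | false | inj₁ none = inj₁ λ { zero → p₀ ; (suc y) → none y }
... | false | inj₂ (x , px , max) =
  inj₂ (suc x , px , λ { {zero} p → ⊥-elim (not-¬ p₀ p) ; {suc y} p → max p })
... | true  | inj₁ none =
  inj₂ (zero , p₀ , λ { {zero} _ → ≤-refl ; {suc y} p → ⊥-elim (not-¬ (none y) p) })
... | true  | inj₂ (x , px , max) with r (suc x) ≤? r zero
...   | yes x≤0 = inj₂ (zero , p₀ , λ { {zero} _ → ≤-refl ; {suc y} p → ≤-trans (max p) x≤0 })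
...   | no  x≰0 = inj₂ (suc x , px , λ { {zero} _ → <⇒≤ (≰⇒> x≰0) ; {suc y} p → max p })

-- Opaque so that below P r x stays rigid: unfolded, the implicit arguments of the lemmas
-- about it could not be recovered by unification.
opaque
  below above : ∀ {n} → (Fin n → Bool) → (Fin n → ℕ) → Fin n → Fin n → Bool
  below P r x y = does (r y <? r x ×-dec P y ≟ᵇ true)
  above P r x y = does (r x <? r y ×-dec P y ≟ᵇ true)

  below-⇔ : ∀ {n P} {r : Fin n → ℕ} {x y} → below P r x y ≡ true ⇔ (r y < r x × P y ≡ true)
  below-⇔ {P = P} {r} {x} {y} = does≡true⇔ (r y <? r x ×-dec P y ≟ᵇ true)

  above-⇔ : ∀ {n P} {r : Fin n → ℕ} {x y} → above P r x y ≡ true ⇔ (r x < r y × P y ≡ true)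
  above-⇔ {P = P} {r} {x} {y} = does≡true⇔ (r x <? r y ×-dec P y ≟ᵇ true)

below⊆ : ∀ {n P} {r : Fin n → ℕ} {x} → below P r x ⊆ P
below⊆ = proj₂ ∘ to below-⇔

module _ {n : ℕ} {r : Fin n → ℕ} {w : Fin n → ℕ} where

  below-cong : ∀ {P Q x} → (∀ {y} → r y < r x → P y ≡ Q y) →
               weight (below P r x) w ≡ weight (below Q r x) w
  below-cong P≗Q = weight-cong {w = w} λ y → ≡true-⇔⇒≡
    (λ e → let (y<x , p) = to below-⇔ e in from below-⇔ (y<x , trans (sym (P≗Q y<x)) p))
    (λ e → let (y<x , q) = to below-⇔ e in from below-⇔ (y<x , trans (P≗Q y<x) q))

  below-mono : ∀ {P x x'} → r x ≤ r x' → weight (below P r x) w ≤ weight (below P r x') w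
  below-mono x≤x' = weight-mono {w = w} λ e →
    let (y<x , p) = to below-⇔ e in from below-⇔ (<-≤-trans y<x x≤x' , p)

  below+self≤ : ∀ {P x} → P x ≡ true → weight (below P r x) w + w x ≤ weight P w
  below+self≤ {P} {x} px =
    subst (λ k → weight (below P r x) w + k ≤ weight P w) (weight-singleton x)
      (weight-disjoint {w = w} below⊆ ｛x｝⊆P (λ e y≡x → <-irrefl (cong r (singleton y≡x)) (proj₁ (to below-⇔ e))))
    where
    singleton : ∀ {y} → ｛ x ｝ y ≡ true → y ≡ x
    singleton {y} = to (does≡true⇔ (y ≟ᶠ x))
    ｛x｝⊆P : ｛ x ｝ ⊆ P
    ｛x｝⊆P e = subst (λ z → P z ≡ true) (sym (singleton e)) px

  below+upper≤ : ∀ {P D x} → D ⊆ P → (∀ {y} → D y ≡ true → r x < r y) →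
                 weight (below P r x) w + weight D w ≤ weight P w
  below+upper≤ D⊆P x<D = weight-disjoint {w = w} below⊆ D⊆P (λ e d → <-asym (proj₁ (to below-⇔ e)) (x<D d))

  weight≤below+above : ∀ {P x} → (∀ {y} → P y ≡ true → r y ≢ r x) →
                       weight P w ≤ weight (below P r x) w + weight (above P r x) w
  weight≤below+above {P} {x} untied = weight-cover {w = w} split
    where
    split : ∀ {y} → P y ≡ true → below P r x y ≡ true ⊎ above P r x y ≡ true
    split {y} p with <-cmp (r y) (r x)
    ... | tri< y<x _ _ = inj₁ (from below-⇔ (y<x , p))
    ... | tri≈ _ y≡x _ = contradiction y≡x (untied p)
    ... | tri> _ _ x<y = inj₂ (from above-⇔ (x<y , p))

  below+self≤⇒weight≤ : ∀ {P t} → InjectiveOn P r →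
                        (∀ {x} → P x ≡ true → weight (below P r x) w + w x ≤ t) → weight P w ≤ t
  below+self≤⇒weight≤ {P} {t} injective bounded with maximumOn P r
  ... | inj₁ none = subst (_≤ t) (sym (weight-empty none)) z≤n
  ... | inj₂ (x , px , max) = ≤-trans (subst (weight P w ≤_) covering (weight-cover {w = w} split)) (bounded px)
    where
    covering : weight (below P r x) w + weight ｛ x ｝ w ≡ weight (below P r x) w + w x
    covering = cong (weight (below P r x) w +_) (weight-singleton x)
    split : ∀ {y} → P y ≡ true → below P r x y ≡ true ⊎ ｛ x ｝ y ≡ true
    split {y} p with y ≟ᶠ x
    ... | yes _   = inj₂ refl
    ... | no  y≢x = inj₁ (from below-⇔ (≤∧≢⇒< (max p) (y≢x ∘ injective y x p px) , p))

module MasterList (I : Instance) (mls : Fin (Instance.nS I) → ℕ)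
  (mls-injective : ∀ s s' → mls s ≡ mls s' → s ≡ s')
  (mls-agrees : ∀ c s s' → Instance.acc I s c ≡ true → Instance.acc I s' c ≡ true →
                (_≻[_]ˢ_ I s c s' ⇔ (mls s < mls s')))
  where

  open Instance I

  seniors : PairSet I → Fin nS → Fin nC → ℕ
  seniors M s c = weight (below (λ s' → M s' c) mls s) (λ _ → 1)

  betterLoad : PairSet I → Fin nS → Fin nC → ℕ
  betterLoad M s c = weight (below (M s) (srank s) c) O

  Admissible : PairSet I → Fin nS → Fin nC → Set
  Admissible M s c = acc s c ≡ true × seniors M s c < q⁺ c × betterLoad M s c + O c ≤ T s

  admissible? : ∀ M s c → Dec (Admissible M s c)
  admissible? M s c = acc s c ≟ᵇ true ×-dec seniors M s c <? q⁺ c ×-dec betterLoad M s c + O c ≤? T s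

  IsGreedy : PairSet I → Set
  IsGreedy M = ∀ s c → M s c ≡ true ⇔ Admissible M s c

  -- width exceeds every srank, so rank orders pairs lexicographically by (mls s, srank s c).
  width : ℕ
  width = suc (Σᶠ λ s → Σᶠ (srank s))

  rank : Fin nS → Fin nC → ℕ
  rank s c = mls s * width + srank s c

  rank<next : ∀ s c → rank s c < suc (mls s) * width
  rank<next s c = begin-strict
    mls s * width + srank s c <⟨ +-monoʳ-< (mls s * width) srank<width ⟩
    mls s * width + width     ≡⟨ +-comm (mls s * width) width ⟩
    suc (mls s) * width       ∎
    where
    open ≤-Reasoning
    srank<width : srank s c < width
    srank<width = s≤s (≤-trans (≤Σᶠ (srank s) c) (≤Σᶠ (λ s → Σᶠ (srank s)) s))

  rank-senior : ∀ {s s' c c'} → mls s' < mls s → rank s' c' < rank s c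
  rank-senior {s} {s'} {c} {c'} s'<s =
    <-≤-trans (rank<next s' c') (≤-trans (*-monoˡ-≤ width s'<s) (m≤m+n (mls s * width) (srank s c)))

  rank-preferred : ∀ {s c c'} → srank s c' < srank s c → rank s c' < rank s c
  rank-preferred {s} = +-monoʳ-< (mls s * width)

  rounds : ℕ
  rounds = suc (Σᶠ mls) * width

  rank<rounds : ∀ s c → rank s c < rounds
  rank<rounds s c = <-≤-trans (rank<next s c) (*-monoˡ-≤ width (s≤s (≤Σᶠ mls s)))

  AgreeBelow : ℕ → PairSet I → PairSet I → Set
  AgreeBelow k M M' = ∀ s c → rank s c < k → M s c ≡ M' s c

  admissible-local : ∀ {k M M' s c} → rank s c ≤ k → AgreeBelow k M M' → Admissible M s c ⇔ Admissible M' s c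
  admissible-local {k} {M} {M'} {s} {c} r≤k agree =
    mk⇔ (transfer seniors≡ betterLoad≡) (transfer (sym seniors≡) (sym betterLoad≡))
    where
    seniors≡ : seniors M s c ≡ seniors M' s c
    seniors≡ = below-cong (λ {s'} s'<s → agree s' c (<-≤-trans (rank-senior s'<s) r≤k))
    betterLoad≡ : betterLoad M s c ≡ betterLoad M' s c
    betterLoad≡ = below-cong (λ {c'} c'<c → agree s c' (<-≤-trans (rank-preferred c'<c) r≤k))
    transfer : ∀ {N N'} → seniors N s c ≡ seniors N' s c → betterLoad N s c ≡ betterLoad N' s c →
               Admissible N s c → Admissible N' s c
    transfer seniors≡ betterLoad≡ (acceptable , room , credit) =
      acceptable , subst (_< q⁺ c) seniors≡ room , subst (λ b → b + O c ≤ T s) betterLoad≡ credit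

  greedyStep : PairSet I → PairSet I
  greedyStep M s c = does (admissible? M s c)

  greedyStep-agree : ∀ {k M M'} → AgreeBelow k M M' → AgreeBelow (suc k) (greedyStep M) (greedyStep M')
  greedyStep-agree {M = M} {M'} agree s c r<1+k =
    does-⇔ (admissible-local (s≤s⁻¹ r<1+k) agree) (admissible? M s c) (admissible? M' s c)

  round : ℕ → PairSet I
  round zero    = λ _ _ → false
  round (suc k) = greedyStep (round k)

  round-settled : ∀ k → AgreeBelow k (round (suc k)) (round k)
  round-settled zero    _ _ ()
  round-settled (suc k) = greedyStep-agree (round-settled k)

  greedyMatching : PairSet I
  greedyMatching = round rounds

  greedyMatching-isGreedy : IsGreedy greedyMatching
  greedyMatching-isGreedy s c =
    subst (λ b → b ≡ true ⇔ Admissible greedyMatching s c)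
          (round-settled rounds s c (rank<rounds s c))
          (does≡true⇔ (admissible? greedyMatching s c))

  isGreedy-unique : ∀ {M M'} → IsGreedy M → IsGreedy M' → ∀ k → AgreeBelow k M M'
  isGreedy-unique greedy greedy' zero    _ _ ()
  isGreedy-unique {M} {M'} greedy greedy' (suc k) s c r<1+k =
    ≡true-⇔⇒≡ (from (greedy' s c) ∘ to local ∘ to (greedy s c)) (from (greedy s c) ∘ from local ∘ to (greedy' s c))
    where
    local : Admissible M s c ⇔ Admissible M' s c
    local = admissible-local (s≤s⁻¹ r<1+k) (isGreedy-unique greedy greedy' k)

  matched⇒admissible : ∀ {M s c} → IsMatching I M → M s c ≡ true → Admissible M s c
  matched⇒admissible {M} {s} {c} (accepted , within-credit , within-quota) m =
    accepted s c m ,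
    subst (_≤ q⁺ c) (+-comm (seniors M s c) 1) (≤-trans seniors+1≤size (within-quota c)) ,
    ≤-trans betterLoad+O≤load (within-credit s)
    where
    seniors+1≤size : seniors M s c + 1 ≤ size I M c
    seniors+1≤size = below+self≤ {n = nS} m
    betterLoad+O≤load : betterLoad M s c + O c ≤ load I M s
    betterLoad+O≤load = below+self≤ {n = nC} m

  module _ {M : PairSet I} (greedy : IsGreedy M) where

    private
      admissible : ∀ {s c} → M s c ≡ true → Admissible M s c
      admissible {s} {c} = to (greedy s c)

    isGreedy⇒isMatching : IsMatching I M
    isGreedy⇒isMatching = (λ s c → proj₁ ∘ admissible) , within-credit , within-quota
      where
      within-credit : ∀ s → load I M s ≤ T s
      within-credit s = below+self≤⇒weight≤
        (λ c c' m m' → srank-inj s c c' (proj₁ (admissible m)) (proj₁ (admissible m')))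
        (proj₂ ∘ proj₂ ∘ admissible)
      within-quota : ∀ c → size I M c ≤ q⁺ c
      within-quota c = below+self≤⇒weight≤
        (λ s s' _ _ → mls-injective s s')
        (λ {s} m → subst (_≤ q⁺ c) (+-comm 1 (seniors M s c)) (proj₁ (proj₂ (admissible m))))

    -- Dropping D frees enough credits, so c refused s for lack of room: q⁺ c students ahead
    -- of s hold c. Then c is full, and a holder ranked below s would have as many seniors.
    isGreedy⇒unblocked : ∀ s c → ¬ BlockingPair I M s c
    isGreedy⇒unblocked s c (accepted , unmatched , competition , D , D⊆ , c≻D , swap-fits) =
      <⇒≱ (competition-fails competition) rejected
      where
      betterLoad+D≤load : betterLoad M s c + credits I D ≤ load I M s
      betterLoad+D≤load = below+upper≤ {n = nC} (D⊆ _) (c≻D _)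
      credit-fits : betterLoad M s c + O c ≤ T s
      credit-fits = ≤-trans (+-monoˡ-≤ (O c) (m+n≤o⇒m≤o∸n (betterLoad M s c) betterLoad+D≤load)) swap-fits
      rejected : q⁺ c ≤ seniors M s c
      rejected = ≮⇒≥ λ room → not-¬ unmatched (from (greedy s c) (accepted , room , credit-fits))
      competition-fails : Undersubscribed I M c ⊎ (∃ λ s' → M s' c ≡ true × crank c s < crank c s') →
                          seniors M s c < q⁺ c
      competition-fails (inj₁ under) = ≤-<-trans seniors≤size under
        where
        seniors≤size : seniors M s c ≤ size I M c
        seniors≤size = weight-mono {n = nS} below⊆
      competition-fails (inj₂ (s' , m' , s≻s')) =
        ≤-<-trans (below-mono {n = nS} (<⇒≤ (to (mls-agrees c s s' accepted (proj₁ (admissible m'))) s≻s')))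
                  (proj₁ (proj₂ (admissible m')))

  isGreedy⇒pairStable : ∀ {M} → IsGreedy M → PairStable I M
  isGreedy⇒pairStable greedy = isGreedy⇒isMatching greedy , isGreedy⇒unblocked greedy

  module _ {M : PairSet I} (matching : IsMatching I M) where

    private
      accepted : ∀ {s c} → M s c ≡ true → acc s c ≡ true
      accepted {s} {c} = proj₁ matching s c

    admissible-unmatched⇒blocking : ∀ {s c} → Admissible M s c → M s c ≡ false → BlockingPair I M s c
    admissible-unmatched⇒blocking {s} {c} (acceptable , room , credit) unmatched =
      acceptable , unmatched , competition , worse ,
      (λ _ → proj₂ ∘ to above-⇔) , (λ _ → proj₁ ∘ to above-⇔) , swap-fits
      where
      worse : Fin nC → Bool
      worse = above (M s) (srank s) c
      juniors : Fin nS → Bool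
      juniors = above (λ s' → M s' c) mls s
      load≤betterLoad+worse : load I M s ≤ betterLoad M s c + credits I worse
      load≤betterLoad+worse = weight≤below+above λ {c'} m c'≡c →
        not-¬ unmatched (subst (λ c'' → M s c'' ≡ true) (srank-inj s c' c (accepted m) acceptable c'≡c) m)
      swap-fits : load I M s ∸ credits I worse + O c ≤ T s
      swap-fits = ≤-trans (+-monoˡ-≤ (O c) (m≤n+o⇒m∸n≤o (load I M s) (credits I worse)
                    (subst (load I M s ≤_) (+-comm (betterLoad M s c) (credits I worse)) load≤betterLoad+worse))) credit
      competition : Undersubscribed I M c ⊎ (∃ λ s' → M s' c ≡ true × crank c s < crank c s')
      competition with any? (λ s' → juniors s' ≟ᵇ true)
      ... | yes (s' , e) =
        let (s<s' , m') = to above-⇔ e in inj₂ (s' , m' , from (mls-agrees c s s' acceptable (accepted m')) s<s')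
      ... | no none = inj₁ (begin-strict
        size I M c                               ≤⟨ weight≤below+above {n = nS} untied ⟩
        seniors M s c + weight juniors (λ _ → 1) ≡⟨ cong (seniors M s c +_) no-juniors ⟩
        seniors M s c + 0                        ≡⟨ +-identityʳ _ ⟩
        seniors M s c                            <⟨ room ⟩
        q⁺ c                                     ∎)
        where
        open ≤-Reasoning
        no-juniors : weight juniors (λ _ → 1) ≡ 0
        no-juniors = weight-empty λ s' → ¬-not λ e → none (s' , e)
        untied : ∀ {s'} → M s' c ≡ true → mls s' ≢ mls s
        untied {s'} m s'≡s = not-¬ unmatched (subst (λ s'' → M s'' c ≡ true) (mls-injective s' s s'≡s) m)

  pairStable⇒isGreedy : ∀ {M} → PairStable I M → IsGreedy M
  pairStable⇒isGreedy {M} (matching , unblocked) s c =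
    mk⇔ (matched⇒admissible matching) admissible⇒matched
    where
    admissible⇒matched : Admissible M s c → M s c ≡ true
    admissible⇒matched admissible with M s c in m
    ... | true  = refl
    ... | false = ⊥-elim (unblocked s c (admissible-unmatched⇒blocking matching admissible m))

mainTheorem7 : (I : Instance) → HasMasterList I →
    Σ (PairSet I) λ M → PairStable I M ×
      ((M' : PairSet I) → PairStable I M' → ∀ s c → M' s c ≡ M s c)
mainTheorem7 I (mls , mls-injective , mls-agrees) =
  greedyMatching ,
  isGreedy⇒pairStable greedyMatching-isGreedy ,
  λ M' stable s c → isGreedy-unique (pairStable⇒isGreedy stable) greedyMatching-isGreedy (suc (rank s c)) s c ≤-refl
  where open MasterList I mls mls-injective mls-agrees
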